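{- Let $T\subseteq\mathbb{B}$ with $\tilde T=T$. Then $\mathcal{D}_T=\langle h_\beta:\beta\in\mathbb{B}-T\rangle+\langle\pm b_\beta:\beta\in T\rangle$, where $\langle\cdot\rangle$ denotes the $\mathbb{Q}^{\ge0}$-cone generated.
   Context: Let $F$ be a totally real field, $p$ unramified in $F$, and $\mathbb{B}=\bigsqcup_{\mathfrak p\mid p}\mathbb{B}_{\mathfrak p}$ the set of embeddings of $F$ into $W(\mathbb{F})[1/p]$ (for a finite field $\mathbb{F}$ containing all residue fields at $p$), grouped by induced prime; Frobenius $\sigma$ acts by $\beta\mapsto\sigma\circ\beta$, transitively on each $\mathbb{B}_{\mathfrak p}$. $e_\beta$ is the standard basis of $\mathbb{Q}^{\mathbb{B}}$. $h_\beta=-e_\beta+pe_{\sigma^{ -1}\beta}$, $b_\beta=e_\beta+pe_{\sigma^{ -1}\beta}$, and for $\beta,\beta'\in\mathbb{B}_{\mathfrak p}$, $0<n\le|\mathbb{B}_{\mathfrak p}|$ with $\sigma^n\beta'=\beta$, $h^{\beta'}_\beta=-e_\beta+p^ne_{\beta'}$. For $T\subseteq\mathbb{B}$: $T_{\mathfrak p}=T\cap\mathbb{B}_{\mathfrak p}$; $\tilde T_{\mathfrak p}=\mathbb{B}_{\mathfrak p}$ if $T_{\mathfrak p}=\mathbb{B}_{\mathfrak p}$, otherwise the union over maximal chains $C=\{\sigma^{ -i}\beta:0\le i\le m\}$ of $T_{\mathfrak p}$ ($\sigma\beta,\sigma^{ -m-1}\beta\notin T_{\mathfrak p}$) of $C$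 if $m$ is odd and $C\cup\{\sigma^{ -m-1}\beta\}$ if $m$ is even; $\tilde T=\bigsqcup\tilde T_{\mathfrak p}$. $\mathcal{D}_T$ is the $\mathbb{Q}^{\ge0}$-cone generated over all $\mathfrak p\mid p$ by $\{h^{\beta'}_\beta:\beta\in\mathbb{B}_{\mathfrak p}-T_{\mathfrak p},\ \beta'\in(\mathbb{B}_{\mathfrak p}-\tilde T_{\mathfrak p})\cup\sigma(\tilde T_{\mathfrak p}-T_{\mathfrak p})\}\cup\{\pm b_\beta:\beta\in T_{\mathfrak p}\}$. -}

module Defs where

open import Data.Nat as ℕ using (ℕ; zero; suc; _≤_; _<_)
open import Data.Nat.DivMod using (_mod_)
open import Data.Fin as Fin using (Fin; toℕ)
open import Data.Fin.Properties as FinP using ()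
open import Data.Integer using (+_)
open import Data.Rational using (ℚ; 0ℚ; 1ℚ; _+_; _*_; -_; _/_) renaming (_≤_ to _≤ℚ_)
open import Data.Product using (Σ; ∃; ∃-syntax; _×_; _,_; proj₁; proj₂)
open import Data.Product.Properties using (≡-dec)
open import Data.Sum using (_⊎_)
open import Data.Bool using (Bool; true; false)
open import Relation.Nullary using (¬_; yes; no)
open import Relation.Binary.PropositionalEquality using (_≡_)

-- Combinatorial model of 𝔹 = ⊔_{𝔭|p} 𝔹_𝔭 : there are k primes 𝔭 above p,
-- the i-th with |𝔹_𝔭| = d i; 𝔹_𝔭 = Fin (d i) and σ acts as the cyclic shift j ↦ j+1.
𝔹 : {k : ℕ} → (Fin k → ℕ) → Set
𝔹 {k} d = Σ (Fin k) (λ i → Fin (d i))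

shift : {n : ℕ} → Fin n → Fin n
shift {suc n} j = suc (toℕ j) mod suc n

unshift : {n : ℕ} → Fin n → Fin n
unshift {suc n} j = (toℕ j ℕ.+ n) mod suc n

σ : {k : ℕ} {d : Fin k → ℕ} → 𝔹 d → 𝔹 d
σ (i , j) = i , shift j

σ⁻¹ : {k : ℕ} {d : Fin k → ℕ} → 𝔹 d → 𝔹 d
σ⁻¹ (i , j) = i , unshift j

σ^ : {k : ℕ} {d : Fin k → ℕ} → ℕ → 𝔹 d → 𝔹 d
σ^ zero β = β
σ^ (suc n) β = σ (σ^ n β)

σ^- : {k : ℕ} {d : Fin k → ℕ} → ℕ → 𝔹 d → 𝔹 d
σ^- zero β = β
σ^- (suc n) β = σ⁻¹ (σ^- n β)

Vecℚ : {k : ℕ} → (Fin k → ℕ) → Set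
Vecℚ d = 𝔹 d → ℚ

ℕtoℚ : ℕ → ℚ
ℕtoℚ n = + n / 1

_+ᵛ_ : {k : ℕ} {d : Fin k → ℕ} → Vecℚ d → Vecℚ d → Vecℚ d
(v +ᵛ w) γ = v γ + w γ

_·ᵛ_ : {k : ℕ} {d : Fin k → ℕ} → ℚ → Vecℚ d → Vecℚ d
(c ·ᵛ v) γ = c * v γ

-ᵛ_ : {k : ℕ} {d : Fin k → ℕ} → Vecℚ d → Vecℚ d
(-ᵛ v) γ = - v γ

_≈ᵛ_ : {k : ℕ} {d : Fin k → ℕ} → Vecℚ d → Vecℚ d → Set
v ≈ᵛ w = ∀ γ → v γ ≡ w γ

e : {k : ℕ} {d : Fin k → ℕ} → 𝔹 d → Vecℚ d
e β γ with ≡-dec Fin._≟_ Fin._≟_ β γ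
... | yes _ = 1ℚ
... | no _ = 0ℚ

h : {k : ℕ} {d : Fin k → ℕ} → ℕ → 𝔹 d → Vecℚ d
h p β = (-ᵛ e β) +ᵛ (ℕtoℚ p ·ᵛ e (σ⁻¹ β))

b : {k : ℕ} {d : Fin k → ℕ} → ℕ → 𝔹 d → Vecℚ d
b p β = e β +ᵛ (ℕtoℚ p ·ᵛ e (σ⁻¹ β))

-- h^{β'}_β = -e_β + p^n e_{β'}  (n with σ^n β' = β, 0 < n ≤ |𝔹_𝔭|)
hh : {k : ℕ} {d : Fin k → ℕ} → ℕ → ℕ → 𝔹 d → 𝔹 d → Vecℚ d
hh p n β β' = (-ᵛ e β) +ᵛ (ℕtoℚ (p ℕ.^ n) ·ᵛ e β')

data Cone {k : ℕ} {d : Fin k → ℕ} (S : Vecℚ d → Set) : Vecℚ d → Set where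
  cone-zero : ∀ v → v ≈ᵛ (λ _ → 0ℚ) → Cone S v
  cone-step : ∀ v w g c → Cone S w → S g → 0ℚ ≤ℚ c →
              v ≈ᵛ (w +ᵛ (c ·ᵛ g)) → Cone S v

Subset𝔹 : {k : ℕ} → (Fin k → ℕ) → Set
Subset𝔹 d = 𝔹 d → Bool

_∈_ : {k : ℕ} {d : Fin k → ℕ} → 𝔹 d → Subset𝔹 d → Set
β ∈ T = T β ≡ true

_∉_ : {k : ℕ} {d : Fin k → ℕ} → 𝔹 d → Subset𝔹 d → Set
β ∉ T = ¬ (β ∈ T)

-- membership in T̃.  γ = (i , _) lies in 𝔹_𝔭 for 𝔭 the i-th prime.
-- Either T_𝔭 = 𝔹_𝔭, or γ lies in C (resp. C ∪ {σ^{-m-1}β} when m is even)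
-- for a maximal chain C = {σ^{-i}β : 0 ≤ i ≤ m} of T_𝔭.
data Even : ℕ → Set where
  even-zero : Even zero
  even-ss : ∀ {n} → Even n → Even (suc (suc n))

Tilde : {k : ℕ} {d : Fin k → ℕ} → Subset𝔹 d → 𝔹 d → Set
Tilde {d = d} T (i , j) =
    (∀ (j' : Fin (d i)) → (i , j') ∈ T)
  ⊎ (Σ (Fin (d i)) λ jβ → Σ ℕ λ m →
       let β = (i , jβ) in
         (∀ n → n ≤ m → σ^- n β ∈ T)
       × (σ β ∉ T)
       × (σ^- (suc m) β ∉ T)
       × ((Σ ℕ λ n → n ≤ m × σ^- n β ≡ (i , j))
          ⊎ (Even m × σ^- (suc m) β ≡ (i , j))))

DGen : {k : ℕ} {d : Fin k → ℕ} → ℕ → Subset𝔹 d → Vecℚ d → Set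
DGen {d = d} p T g =
    (Σ (𝔹 d) λ β → Σ (𝔹 d) λ β' → Σ ℕ λ n →
        β ∉ T
      × ((¬ Tilde T β') ⊎ (Σ (𝔹 d) λ γ → Tilde T γ × γ ∉ T × β' ≡ σ γ))
      × 0 < n × n ≤ d (proj₁ β) × σ^ n β' ≡ β
      × g ≈ᵛ hh p n β β')
  ⊎ (Σ (𝔹 d) λ β → β ∈ T × (g ≈ᵛ b p β ⊎ g ≈ᵛ (-ᵛ b p β)))

RGen : {k : ℕ} {d : Fin k → ℕ} → ℕ → Subset𝔹 d → Vecℚ d → Set
RGen {d = d} p T g =
    (Σ (𝔹 d) λ β → β ∉ T × g ≈ᵛ h p β)
  ⊎ (Σ (𝔹 d) λ β → β ∈ T × (g ≈ᵛ b p β ⊎ g ≈ᵛ (-ᵛ b p β)))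

{-# OPTIONS --safe #-}
-- Write H n β for h^{σ⁻ⁿβ}_β = -e_β + pⁿ e_{σ⁻ⁿβ}. Then H 1 β = h_β, H 2 β = -b_β + p b_{σ⁻¹β}, and
-- H (m + n) β = H m β + pᵐ H n (σ⁻ᵐβ). Hence along a chain of T of even length H lies in the
-- span of the b's, which both cones contain. T̃ = T says exactly that the maximal chain of T
-- just below a point β ∉ T has even length m, so h_β and the generator H (1 + m) β of 𝒟_T differ
-- by such a span element; conversely every generator of 𝒟_T is cut at its points outside T
-- into pieces of this form.
module Submission where

open import Defs
open import Data.Nat using (ℕ; _≤_)
open import Data.Nat.Primality using (Prime)
open import Data.Fin using (Fin)
open import Data.Product using (_×_; _,_)
open import Relation.Binary.PropositionalEquality using (_≡_)
open import Data.Bool using (true)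

open import Data.Nat using (zero; suc; _+_; _*_; _^_; _<_; z≤n; s≤s; NonZero)
open import Data.Nat.Properties
  using (+-comm; +-assoc; +-suc; +-identityʳ; *-comm; *-identityʳ; ^-distribˡ-+-*; m≤n+m; m≤n⇒∃[o]m+o≡n)
open import Data.Nat.DivMod using (_%_; %-distribˡ-+; m%n%n≡m%n; [m+n]%n≡m%n; [m+kn]%n≡m%n; m<n⇒m%n≡m)
open import Data.Nat.Coprimality using (Coprime; 1-coprimeTo) renaming (sym to coprime-sym)
open import Data.Nat.Induction using (<-rec)
open import Data.Fin using (toℕ)
open import Data.Fin.Properties using (toℕ-fromℕ<; toℕ-injective; toℕ<n)
open import Data.Integer as ℤ using ()
open import Data.Integer.Properties using (pos-*)
open import Data.Rational as ℚ using (ℚ; 0ℚ; 1ℚ; mkℚ; nonNegative) renaming (_≤_ to _≤ℚ_)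
open import Data.Rational.Properties
  using (normalize-coprime; normalize-nonNeg; nonNegative⁻¹; nonNeg*nonNeg⇒nonNeg; +-identityˡ; *-zeroʳ)
open import Data.Rational.Solver using (module +-*-Solver)
open import Data.Product using (∃; proj₁; proj₂)
open import Data.Sum using (_⊎_; inj₁; inj₂)
open import Data.Bool.Properties using () renaming (_≟_ to _≟ᵇ_)
open import Function using (_∘_)
open import Relation.Nullary using (¬_; yes; no; contradiction)
open import Relation.Unary using (Decidable)
open import Relation.Binary.PropositionalEquality using (refl; sym; trans; cong; cong₂; subst; module ≡-Reasoning)

open +-*-Solver

[m%n+k]%n≡[m+k]%n : ∀ m k n .{{_ : NonZero n}} → (m % n + k) % n ≡ (m + k) % n
[m%n+k]%n≡[m+k]%n m k n = begin
  (m % n + k) % n          ≡⟨ %-distribˡ-+ (m % n) k n ⟩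
  (m % n % n + k % n) % n  ≡⟨ cong (λ t → (t + k % n) % n) (m%n%n≡m%n m n) ⟩
  (m % n + k % n) % n      ≡⟨ %-distribˡ-+ m k n ⟨
  (m + k) % n              ∎
  where open ≡-Reasoning

module _ {n : ℕ} where

  toℕ-shift : (j : Fin (suc n)) → toℕ (shift j) ≡ suc (toℕ j) % suc n
  toℕ-shift j = toℕ-fromℕ< _

  toℕ-unshift : (j : Fin (suc n)) → toℕ (unshift j) ≡ (toℕ j + n) % suc n
  toℕ-unshift j = toℕ-fromℕ< _

  toℕ+period%≡toℕ : (j : Fin (suc n)) → (toℕ j + suc n) % suc n ≡ toℕ j
  toℕ+period%≡toℕ j = trans ([m+n]%n≡m%n (toℕ j) (suc n)) (m<n⇒m%n≡m (toℕ<n j))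

shift∘unshift : ∀ {n} (j : Fin n) → shift (unshift j) ≡ j
shift∘unshift {suc n} j = toℕ-injective (begin
  toℕ (shift (unshift j))            ≡⟨ toℕ-shift (unshift j) ⟩
  suc (toℕ (unshift j)) % suc n      ≡⟨ cong (λ t → suc t % suc n) (toℕ-unshift j) ⟩
  suc ((toℕ j + n) % suc n) % suc n  ≡⟨ cong (_% suc n) (+-comm 1 _) ⟩
  ((toℕ j + n) % suc n + 1) % suc n  ≡⟨ [m%n+k]%n≡[m+k]%n (toℕ j + n) 1 (suc n) ⟩
  (toℕ j + n + 1) % suc n            ≡⟨ cong (_% suc n) (+-assoc (toℕ j) n 1) ⟩
  (toℕ j + (n + 1)) % suc n          ≡⟨ cong (λ t → (toℕ j + t) % suc n) (+-comm n 1) ⟩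
  (toℕ j + suc n) % suc n            ≡⟨ toℕ+period%≡toℕ j ⟩
  toℕ j                              ∎)
  where open ≡-Reasoning

unshift∘shift : ∀ {n} (j : Fin n) → unshift (shift j) ≡ j
unshift∘shift {suc n} j = toℕ-injective (begin
  toℕ (unshift (shift j))            ≡⟨ toℕ-unshift (shift j) ⟩
  (toℕ (shift j) + n) % suc n        ≡⟨ cong (λ t → (t + n) % suc n) (toℕ-shift j) ⟩
  (suc (toℕ j) % suc n + n) % suc n  ≡⟨ [m%n+k]%n≡[m+k]%n (suc (toℕ j)) n (suc n) ⟩
  (suc (toℕ j) + n) % suc n          ≡⟨ cong (_% suc n) (sym (+-suc (toℕ j) n)) ⟩
  (toℕ j + suc n) % suc n            ≡⟨ toℕ+period%≡toℕ j ⟩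
  toℕ j                              ∎)
  where open ≡-Reasoning

unshift^ : ∀ {n} → ℕ → Fin n → Fin n
unshift^ zero    j = j
unshift^ (suc m) j = unshift (unshift^ m j)

toℕ-unshift^ : ∀ {n} m (j : Fin (suc n)) → toℕ (unshift^ m j) ≡ (toℕ j + m * n) % suc n
toℕ-unshift^ {n} zero j = sym (trans (cong (_% suc n) (+-identityʳ (toℕ j))) (m<n⇒m%n≡m (toℕ<n j)))
toℕ-unshift^ {n} (suc m) j = begin
  toℕ (unshift (unshift^ m j))               ≡⟨ toℕ-unshift (unshift^ m j) ⟩
  (toℕ (unshift^ m j) + n) % suc n           ≡⟨ cong (λ t → (t + n) % suc n) (toℕ-unshift^ m j) ⟩
  ((toℕ j + m * n) % suc n + n) % suc n      ≡⟨ [m%n+k]%n≡[m+k]%n (toℕ j + m * n) n (suc n) ⟩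
  (toℕ j + m * n + n) % suc n                ≡⟨ cong (_% suc n) (+-assoc (toℕ j) (m * n) n) ⟩
  (toℕ j + (m * n + n)) % suc n              ≡⟨ cong (λ t → (toℕ j + t) % suc n) (+-comm (m * n) n) ⟩
  (toℕ j + suc m * n) % suc n                ∎
  where open ≡-Reasoning

unshift^-period : ∀ {n} (j : Fin n) → unshift^ n j ≡ j
unshift^-period {suc n} j = toℕ-injective (begin
  toℕ (unshift^ (suc n) j)        ≡⟨ toℕ-unshift^ (suc n) j ⟩
  (toℕ j + suc n * n) % suc n     ≡⟨ cong (λ t → (toℕ j + t) % suc n) (*-comm (suc n) n) ⟩
  (toℕ j + n * suc n) % suc n     ≡⟨ [m+kn]%n≡m%n (toℕ j) n (suc n) ⟩
  toℕ j % suc n                   ≡⟨ m<n⇒m%n≡m (toℕ<n j) ⟩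
  toℕ j                           ∎)
  where open ≡-Reasoning

module _ {k : ℕ} {d : Fin k → ℕ} where

  σ∘σ⁻¹ : (β : 𝔹 d) → σ (σ⁻¹ β) ≡ β
  σ∘σ⁻¹ (i , j) = cong (i ,_) (shift∘unshift j)

  σ⁻¹∘σ : (β : 𝔹 d) → σ⁻¹ (σ β) ≡ β
  σ⁻¹∘σ (i , j) = cong (i ,_) (unshift∘shift j)

  σ^--+ : ∀ m n (β : 𝔹 d) → σ^- n (σ^- m β) ≡ σ^- (m + n) β
  σ^--+ m zero    β = cong (λ t → σ^- t β) (sym (+-identityʳ m))
  σ^--+ m (suc n) β = trans (cong σ⁻¹ (σ^--+ m n β)) (cong (λ t → σ^- t β) (sym (+-suc m n)))

  σ^∘σ^- : ∀ n (β : 𝔹 d) → σ^ n (σ^- n β) ≡ β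
  σ^∘σ^- zero    β = refl
  σ^∘σ^- (suc n) β = begin
    σ (σ^ n (σ^- (suc n) β))  ≡⟨ cong (σ ∘ σ^ n) (σ^--+ 1 n β) ⟨
    σ (σ^ n (σ^- n (σ⁻¹ β)))  ≡⟨ cong σ (σ^∘σ^- n (σ⁻¹ β)) ⟩
    σ (σ⁻¹ β)                 ≡⟨ σ∘σ⁻¹ β ⟩
    β                         ∎
    where open ≡-Reasoning

  σ^-∘σ^ : ∀ n (β : 𝔹 d) → σ^- n (σ^ n β) ≡ β
  σ^-∘σ^ zero    β = refl
  σ^-∘σ^ (suc n) β = begin
    σ^- (suc n) (σ (σ^ n β))     ≡⟨ σ^--+ 1 n (σ (σ^ n β)) ⟨
    σ^- n (σ⁻¹ (σ (σ^ n β)))     ≡⟨ cong (σ^- n) (σ⁻¹∘σ (σ^ n β)) ⟩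
    σ^- n (σ^ n β)               ≡⟨ σ^-∘σ^ n β ⟩
    β                            ∎
    where open ≡-Reasoning

  σ^--pair : ∀ n i (j : Fin (d i)) → σ^- {d = d} n (i , j) ≡ (i , unshift^ n j)
  σ^--pair zero    i j = refl
  σ^--pair (suc n) i j = cong σ⁻¹ (σ^--pair n i j)

  σ^--period : (β : 𝔹 d) → σ^- (d (proj₁ β)) β ≡ β
  σ^--period (i , j) = trans (σ^--pair (d i) i j) (cong (i ,_) (unshift^-period j))

coprimeTo-1 : ∀ n → Coprime n 1
coprimeTo-1 n = coprime-sym (1-coprimeTo n)

ℕtoℚ≡mkℚ : ∀ n → ℕtoℚ n ≡ mkℚ (ℤ.+ n) 0 (coprimeTo-1 n)
ℕtoℚ≡mkℚ n = normalize-coprime (coprimeTo-1 n)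

ℕtoℚ-* : ∀ m n → ℕtoℚ (m * n) ≡ ℕtoℚ m ℚ.* ℕtoℚ n
ℕtoℚ-* m n = begin
  ℕtoℚ (m * n)                            ≡⟨ cong (ℚ._/ 1) (pos-* m n) ⟩
  (ℤ.+ m ℤ.* ℤ.+ n) ℚ./ 1                 ≡⟨⟩
  mkℚ (ℤ.+ m) 0 (coprimeTo-1 m) ℚ.* mkℚ (ℤ.+ n) 0 (coprimeTo-1 n)
                                          ≡⟨ cong₂ ℚ._*_ (ℕtoℚ≡mkℚ m) (ℕtoℚ≡mkℚ n) ⟨
  ℕtoℚ m ℚ.* ℕtoℚ n                       ∎
  where open ≡-Reasoning

ℕtoℚ-nonNeg : ∀ n → 0ℚ ≤ℚ ℕtoℚ n
ℕtoℚ-nonNeg n = nonNegative⁻¹ (ℕtoℚ n) {{normalize-nonNeg n 1}}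

*-nonNeg : ∀ {x y} → 0ℚ ≤ℚ x → 0ℚ ≤ℚ y → 0ℚ ≤ℚ x ℚ.* y
*-nonNeg {x} {y} x≥0 y≥0 =
  nonNegative⁻¹ (x ℚ.* y) {{nonNeg*nonNeg⇒nonNeg x {{nonNegative x≥0}} y {{nonNegative y≥0}}}}

module _ {k : ℕ} {d : Fin k → ℕ} {S : Vecℚ d → Set} where

  Cone-resp-≈ᵛ : ∀ {v w} → v ≈ᵛ w → Cone S v → Cone S w
  Cone-resp-≈ᵛ v≈w (cone-zero _ v≈0) = cone-zero _ (λ γ → trans (sym (v≈w γ)) (v≈0 γ))
  Cone-resp-≈ᵛ v≈w (cone-step _ u g c u∈ g∈S c≥0 v≈) =
    cone-step _ u g c u∈ g∈S c≥0 (λ γ → trans (sym (v≈w γ)) (v≈ γ))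

  Cone-+ : ∀ {v w} → Cone S v → Cone S w → Cone S (v +ᵛ w)
  Cone-+ {w = w} (cone-zero v v≈0) w∈ =
    Cone-resp-≈ᵛ (λ γ → sym (trans (cong (ℚ._+ w γ) (v≈0 γ)) (+-identityˡ (w γ)))) w∈
  Cone-+ {w = w} (cone-step v u g c u∈ g∈S c≥0 v≈) w∈ =
    cone-step _ (u +ᵛ w) g c (Cone-+ u∈ w∈) g∈S c≥0 (λ γ → trans (cong (ℚ._+ w γ) (v≈ γ))
      (solve 4 (λ U W C G → (U :+ C :* G) :+ W := (U :+ W) :+ C :* G) refl (u γ) (w γ) c (g γ)))

  Cone-· : ∀ {c v} → 0ℚ ≤ℚ c → Cone S v → Cone S (c ·ᵛ v)
  Cone-· {c} c≥0 (cone-zero v v≈0) =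
    cone-zero _ (λ γ → trans (cong (c ℚ.*_) (v≈0 γ)) (*-zeroʳ c))
  Cone-· {c} c≥0 (cone-step v u g a u∈ g∈S a≥0 v≈) =
    cone-step _ (c ·ᵛ u) g (c ℚ.* a) (Cone-· c≥0 u∈) g∈S (*-nonNeg c≥0 a≥0)
      (λ γ → trans (cong (c ℚ.*_) (v≈ γ))
      (solve 4 (λ C U A G → C :* (U :+ A :* G) := C :* U :+ (C :* A) :* G) refl c (u γ) a (g γ)))

  Cone-gen : ∀ {g} → S g → Cone S g
  Cone-gen {g} g∈S = cone-step g (λ _ → 0ℚ) g 1ℚ (cone-zero _ (λ _ → refl)) g∈S (ℕtoℚ-nonNeg 1)
    (λ γ → solve 1 (λ G → G := con 0ℚ :+ con 1ℚ :* G) refl (g γ))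

Cone-⊆ : ∀ {k} {d : Fin k → ℕ} {S S′ : Vecℚ d → Set} →
         (∀ {g} → S g → Cone S′ g) → ∀ {v} → Cone S v → Cone S′ v
Cone-⊆ S⊆ (cone-zero v v≈0) = cone-zero v v≈0
Cone-⊆ S⊆ (cone-step v u g c u∈ g∈S c≥0 v≈) =
  Cone-resp-≈ᵛ (λ γ → sym (v≈ γ)) (Cone-+ (Cone-⊆ S⊆ u∈) (Cone-· c≥0 (S⊆ g∈S)))

Lineality : ∀ {k} {d : Fin k → ℕ} → (Vecℚ d → Set) → Vecℚ d → Set
Lineality S v = Cone S v × Cone S (-ᵛ v)

module _ {k : ℕ} {d : Fin k → ℕ} {S : Vecℚ d → Set} where

  Lineality-resp-≈ᵛ : ∀ {v w} → v ≈ᵛ w → Lineality S v → Lineality S w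
  Lineality-resp-≈ᵛ v≈w (v∈ , -v∈) = Cone-resp-≈ᵛ v≈w v∈ , Cone-resp-≈ᵛ (λ γ → cong ℚ.-_ (v≈w γ)) -v∈

  Lineality-0 : ∀ {v} → v ≈ᵛ (λ _ → 0ℚ) → Lineality S v
  Lineality-0 v≈0 = cone-zero _ v≈0 , cone-zero _ (λ γ → cong ℚ.-_ (v≈0 γ))

  Lineality-gen : ∀ {g} → S g → S (-ᵛ g) → Lineality S g
  Lineality-gen g∈S -g∈S = Cone-gen g∈S , Cone-gen -g∈S

  Lineality-neg : ∀ {v} → Lineality S v → Lineality S (-ᵛ v)
  Lineality-neg {v} (v∈ , -v∈) = -v∈ , Cone-resp-≈ᵛ (λ γ → solve 1 (λ V → V := :- (:- V)) refl (v γ)) v∈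

  Lineality-+ : ∀ {v w} → Lineality S v → Lineality S w → Lineality S (v +ᵛ w)
  Lineality-+ {v} {w} (v∈ , -v∈) (w∈ , -w∈) =
    Cone-+ v∈ w∈ ,
    Cone-resp-≈ᵛ (λ γ → solve 2 (λ V W → (:- V) :+ (:- W) := :- (V :+ W)) refl (v γ) (w γ)) (Cone-+ -v∈ -w∈)

  Lineality-· : ∀ {c v} → 0ℚ ≤ℚ c → Lineality S v → Lineality S (c ·ᵛ v)
  Lineality-· {c} {v} c≥0 (v∈ , -v∈) =
    Cone-· c≥0 v∈ ,
    Cone-resp-≈ᵛ (λ γ → solve 2 (λ C V → C :* (:- V) := :- (C :* V)) refl c (v γ)) (Cone-· c≥0 -v∈)

least-counterexample : ∀ {P : ℕ → Set} → Decidable P → ∀ n → ¬ P n →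
                       ∃ λ m → m ≤ n × (∀ i → i < m → P i) × ¬ P m
least-counterexample P? n ¬Pn with P? 0
... | no ¬P0 = 0 , z≤n , (λ _ ()) , ¬P0
least-counterexample P? zero    ¬Pn | yes P0 = contradiction P0 ¬Pn
least-counterexample {P} P? (suc n) ¬Pn | yes P0 with least-counterexample (P? ∘ suc) n ¬Pn
... | m , m≤n , P<m , ¬Pm = suc m , s≤s m≤n , P<suc-m , ¬Pm
  where
  P<suc-m : ∀ i → i < suc m → P i
  P<suc-m zero    _         = P0
  P<suc-m (suc i) (s≤s i<m) = P<m i i<m

even⊎even-suc : ∀ n → Even n ⊎ Even (suc n)
even⊎even-suc zero = inj₁ even-zero
even⊎even-suc (suc n) with even⊎even-suc n
... | inj₁ ev = inj₂ (even-ss ev)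
... | inj₂ ev = inj₁ ev

module _ {k : ℕ} {d : Fin k → ℕ} (T : Subset𝔹 d) (Tilde⊆T : ∀ β → Tilde T β → β ∈ T) where

  -- A maximal chain of odd length would put the point just below it into T̃.
  maximal-chain-even : ∀ {m} β → σ β ∉ T → (∀ i → i < m → σ^- i β ∈ T) → σ^- m β ∉ T → Even m
  maximal-chain-even {zero}  _       _      _     _         = even-zero
  maximal-chain-even {suc m} (i , j) top∉T chain bottom∉T with even⊎even-suc m
  ... | inj₂ ev = ev
  ... | inj₁ ev = contradiction (subst (_∈ T) (sym (σ^--pair (suc m) i j)) (Tilde⊆T _ bottom∈T̃)) bottom∉T
    where
    bottom∈T̃ : Tilde T (i , unshift^ (suc m) j)
    bottom∈T̃ = inj₂ (j , m , (λ n n≤m → chain n (s≤s n≤m)) , top∉T , bottom∉T ,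
                     inj₂ (ev , σ^--pair (suc m) i j))

  even-chain-below : ∀ n β → β ∉ T → σ^- (suc n) β ∉ T →
                     ∃ λ m → m ≤ n × Even m × (∀ i → i < m → σ^- i (σ⁻¹ β) ∈ T) × σ^- m (σ⁻¹ β) ∉ T
  even-chain-below n β β∉T end∉T
    with least-counterexample (λ i → T (σ^- i (σ⁻¹ β)) ≟ᵇ true) n (end∉T ∘ subst (_∈ T) (σ^--+ 1 n β))
  ... | m , m≤n , chain , bottom∉T =
    m , m≤n , maximal-chain-even (σ⁻¹ β) (β∉T ∘ subst (_∈ T) (σ∘σ⁻¹ β)) chain bottom∉T , chain , bottom∉T

module _ (p : ℕ) {k : ℕ} {d : Fin k → ℕ} where

  p^ : ℕ → ℚ
  p^ n = ℕtoℚ (p ^ n)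

  p^-+ : ∀ m n → p^ (m + n) ≡ p^ m ℚ.* p^ n
  p^-+ m n = trans (cong ℕtoℚ (^-distribˡ-+-* p m n)) (ℕtoℚ-* (p ^ m) (p ^ n))

  p^1 : p^ 1 ≡ ℕtoℚ p
  p^1 = cong ℕtoℚ (*-identityʳ p)

  H : ℕ → 𝔹 d → Vecℚ d
  H n β = hh p n β (σ^- n β)

  H-0 : ∀ β → H 0 β ≈ᵛ (λ _ → 0ℚ)
  H-0 β γ = solve 1 (λ E → (:- E) :+ con (ℕtoℚ 1) :* E := con 0ℚ) refl (e β γ)

  H-1 : ∀ β → H 1 β ≈ᵛ h p β
  H-1 β γ = cong (λ c → ℚ.- e β γ ℚ.+ c ℚ.* e (σ⁻¹ β) γ) p^1

  H-+ : ∀ m n β → (H m β +ᵛ (p^ m ·ᵛ H n (σ^- m β))) ≈ᵛ H (m + n) β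
  H-+ m n β γ = begin
    (ℚ.- e β γ ℚ.+ p^ m ℚ.* e β′ γ) ℚ.+ p^ m ℚ.* (ℚ.- e β′ γ ℚ.+ p^ n ℚ.* e (σ^- n β′) γ)
      ≡⟨ solve 5 (λ X M Y N Z → (:- X :+ M :* Y) :+ M :* (:- Y :+ N :* Z) := :- X :+ (M :* N) :* Z)
                 refl (e β γ) (p^ m) (e β′ γ) (p^ n) (e (σ^- n β′) γ) ⟩
    ℚ.- e β γ ℚ.+ (p^ m ℚ.* p^ n) ℚ.* e (σ^- n β′) γ
      ≡⟨ cong₂ (λ c z → ℚ.- e β γ ℚ.+ c ℚ.* e z γ) (sym (p^-+ m n)) (σ^--+ m n β) ⟩
    ℚ.- e β γ ℚ.+ p^ (m + n) ℚ.* e (σ^- (m + n) β) γ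
      ∎
    where
    open ≡-Reasoning
    β′ = σ^- m β

  H-2 : ∀ β → ((-ᵛ b p β) +ᵛ (ℕtoℚ p ·ᵛ b p (σ⁻¹ β))) ≈ᵛ H 2 β
  H-2 β γ = begin
    ℚ.- (e β γ ℚ.+ q ℚ.* e β₁ γ) ℚ.+ q ℚ.* (e β₁ γ ℚ.+ q ℚ.* e β₂ γ)
      ≡⟨ solve 4 (λ X Q Y Z → :- (X :+ Q :* Y) :+ Q :* (Y :+ Q :* Z) := :- X :+ (Q :* Q) :* Z)
                 refl (e β γ) q (e β₁ γ) (e β₂ γ) ⟩
    ℚ.- e β γ ℚ.+ (q ℚ.* q) ℚ.* e β₂ γ
      ≡⟨ cong (λ c → ℚ.- e β γ ℚ.+ c ℚ.* e β₂ γ) (cong₂ ℚ._*_ (sym p^1) (sym p^1)) ⟩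
    ℚ.- e β γ ℚ.+ (p^ 1 ℚ.* p^ 1) ℚ.* e β₂ γ
      ≡⟨ cong (λ c → ℚ.- e β γ ℚ.+ c ℚ.* e β₂ γ) (p^-+ 1 1) ⟨
    ℚ.- e β γ ℚ.+ p^ 2 ℚ.* e β₂ γ
      ∎
    where
    open ≡-Reasoning
    q = ℕtoℚ p
    β₁ = σ⁻¹ β
    β₂ = σ⁻¹ β₁

  module _ {S : Vecℚ d → Set} where

    Cone-H-+ : ∀ {m n β} → Cone S (H m β) → Cone S (H n (σ^- m β)) → Cone S (H (m + n) β)
    Cone-H-+ {m} {n} {β} m∈ n∈ = Cone-resp-≈ᵛ (H-+ m n β) (Cone-+ m∈ (Cone-· (ℕtoℚ-nonNeg (p ^ m)) n∈))

    Lineality-H-+ : ∀ {m n β} → Lineality S (H m β) → Lineality S (H n (σ^- m β)) → Lineality S (H (m + n) β)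
    Lineality-H-+ {m} {n} {β} m∈ n∈ =
      Lineality-resp-≈ᵛ (H-+ m n β) (Lineality-+ m∈ (Lineality-· (ℕtoℚ-nonNeg (p ^ m)) n∈))

    Cone-H-∸ : ∀ {m n β} → Cone S (H (m + n) β) → Lineality S (H n (σ^- m β)) → Cone S (H m β)
    Cone-H-∸ {m} {n} {β} m+n∈ (_ , -n∈) =
      Cone-resp-≈ᵛ cancel (Cone-+ m+n∈ (Cone-· (ℕtoℚ-nonNeg (p ^ m)) -n∈))
      where
      cancel : (H (m + n) β +ᵛ (p^ m ·ᵛ (-ᵛ H n (σ^- m β)))) ≈ᵛ H m β
      cancel γ = trans (cong (ℚ._+ p^ m ℚ.* ℚ.- H n (σ^- m β) γ) (sym (H-+ m n β γ)))
        (solve 3 (λ X M Y → (X :+ M :* Y) :+ M :* (:- Y) := X) refl (H m β γ) (p^ m) (H n (σ^- m β) γ))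

  module _ (T : Subset𝔹 d) where

    Contains±b : (Vecℚ d → Set) → Set
    Contains±b S = ∀ {β} → β ∈ T → S (b p β) × S (-ᵛ b p β)

    RGen-±b : Contains±b (RGen p T)
    RGen-±b β∈T = inj₂ (_ , β∈T , inj₁ (λ _ → refl)) , inj₂ (_ , β∈T , inj₂ (λ _ → refl))

    DGen-±b : Contains±b (DGen p T)
    DGen-±b β∈T = inj₂ (_ , β∈T , inj₁ (λ _ → refl)) , inj₂ (_ , β∈T , inj₂ (λ _ → refl))

    Lineality-H-even-chain : ∀ {S} → Contains±b S → ∀ {n β} → Even n → (∀ i → i < n → σ^- i β ∈ T) →
                             Lineality S (H n β)
    Lineality-H-even-chain ±b {β = β} even-zero _ = Lineality-0 (H-0 β)
    Lineality-H-even-chain {S} ±b {β = β} (even-ss {n} ev) chain =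
      Lineality-H-+ {m = 2} {n = n} {β = β} H2∈ (Lineality-H-even-chain ±b ev chain′)
      where
      b∈ : ∀ {β} → β ∈ T → Lineality S (b p β)
      b∈ β∈T = Lineality-gen (proj₁ (±b β∈T)) (proj₂ (±b β∈T))
      H2∈ : Lineality S (H 2 β)
      H2∈ = Lineality-resp-≈ᵛ (H-2 β)
        (Lineality-+ (Lineality-neg (b∈ (chain 0 (s≤s z≤n))))
                     (Lineality-· (ℕtoℚ-nonNeg p) (b∈ (chain 1 (s≤s (s≤s z≤n))))))
      chain′ : ∀ i → i < n → σ^- i (σ^- 2 β) ∈ T
      chain′ i i<n = subst (_∈ T) (sym (σ^--+ 2 i β)) (chain (2 + i) (s≤s (s≤s i<n)))

    module _ (Tilde⊆T : ∀ β → Tilde T β → β ∈ T) where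

      H∈Cone-RGen : ∀ n β → β ∉ T → σ^- n β ∉ T → Cone (RGen p T) (H n β)
      H∈Cone-RGen = <-rec Goal step
        where
        Goal : ℕ → Set
        Goal n = ∀ β → β ∉ T → σ^- n β ∉ T → Cone (RGen p T) (H n β)
        step : ∀ n → (∀ {r} → r < n → Goal r) → Goal n
        step zero    _  β _   _     = cone-zero _ (H-0 β)
        step (suc n) IH β β∉T end∉T with even-chain-below T Tilde⊆T n β β∉T end∉T
        ... | m , m≤n , ev , chain , bottom∉T with m≤n⇒∃[o]m+o≡n m≤n
        ... | r , refl = Cone-H-+ {m = 1} {n = m + r} {β = β} h∈ (Cone-H-+ {m = m} {n = r} {β = σ⁻¹ β} chain∈ rest∈)
          where
          h∈ : Cone (RGen p T) (H 1 β)
          h∈ = Cone-gen (inj₁ (β , β∉T , H-1 β))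
          chain∈ : Cone (RGen p T) (H m (σ⁻¹ β))
          chain∈ = proj₁ (Lineality-H-even-chain RGen-±b ev chain)
          rest∈ : Cone (RGen p T) (H r (σ^- m (σ⁻¹ β)))
          rest∈ = IH (s≤s (m≤n+m r m)) _ bottom∉T
                     (end∉T ∘ subst (_∈ T) (trans (σ^--+ m r (σ⁻¹ β)) (σ^--+ 1 (m + r) β)))

      h∈Cone-DGen : (∀ i → 1 ≤ d i) → ∀ β → β ∉ T → Cone (DGen p T) (h p β)
      h∈Cone-DGen d≥1 β β∉T with m≤n⇒∃[o]m+o≡n (d≥1 (proj₁ β))
      ... | n , 1+n≡d with even-chain-below T Tilde⊆T n β β∉T (β∉T ∘ subst (_∈ T) σ^-[1+n]β≡β)
        where
        σ^-[1+n]β≡β : σ^- (suc n) β ≡ β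
        σ^-[1+n]β≡β = trans (cong (λ t → σ^- t β) 1+n≡d) (σ^--period β)
      ... | m , m≤n , ev , chain , bottom∉T =
        Cone-resp-≈ᵛ (H-1 β)
          (Cone-H-∸ {m = 1} {n = m} {β = β} (Cone-gen generator) (Lineality-H-even-chain DGen-±b ev chain))
        where
        bottom∉T′ : σ^- (suc m) β ∉ T
        bottom∉T′ = bottom∉T ∘ subst (_∈ T) (sym (σ^--+ 1 m β))
        generator : DGen p T (H (suc m) β)
        generator = inj₁ (β , σ^- (suc m) β , suc m , β∉T , inj₁ (bottom∉T′ ∘ Tilde⊆T _) , s≤s z≤n ,
                          subst (suc m ≤_) 1+n≡d (s≤s m≤n) , σ^∘σ^- (suc m) β , λ _ → refl)

      RGen⊆Cone-DGen : (∀ i → 1 ≤ d i) → ∀ {g} → RGen p T g → Cone (DGen p T) g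
      RGen⊆Cone-DGen d≥1 (inj₁ (β , β∉T , g≈h)) =
        Cone-resp-≈ᵛ (λ γ → sym (g≈h γ)) (h∈Cone-DGen d≥1 β β∉T)
      RGen⊆Cone-DGen _   (inj₂ ±b) = Cone-gen (inj₂ ±b)

      DGen⊆Cone-RGen : (∀ β → β ∈ T → Tilde T β) → ∀ {g} → DGen p T g → Cone (RGen p T) g
      DGen⊆Cone-RGen _ (inj₂ ±b) = Cone-gen (inj₂ ±b)
      DGen⊆Cone-RGen _ (inj₁ (_ , _ , _ , _ , inj₂ (γ , γ∈T̃ , γ∉T , _) , _)) =
        contradiction (Tilde⊆T γ γ∈T̃) γ∉T
      DGen⊆Cone-RGen T⊆Tilde (inj₁ (β , β′ , n , β∉T , inj₁ β′∉T̃ , _ , _ , σⁿβ′≡β , g≈)) =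
        Cone-resp-≈ᵛ (λ γ → sym (g≈ γ))
          (subst (Cone (RGen p T) ∘ hh p n β) endpoint
            (H∈Cone-RGen n β β∉T (β′∉T̃ ∘ T⊆Tilde β′ ∘ subst (_∈ T) endpoint)))
        where
        endpoint : σ^- n β ≡ β′
        endpoint = trans (cong (σ^- n) (sym σⁿβ′≡β)) (σ^-∘σ^ n β′)

lemma5p2 : (p : ℕ) → Prime p → (k : ℕ) → (d : Fin k → ℕ) → (∀ i → 1 ≤ d i)
    → (T : Subset𝔹 d) → (∀ γ → (Tilde T γ → T γ ≡ true) × (T γ ≡ true → Tilde T γ))
    → ∀ (v : Vecℚ d) → (Cone (DGen p T) v → Cone (RGen p T) v) × (Cone (RGen p T) v → Cone (DGen p T) v)
lemma5p2 p _ k d d≥1 T T̃≡T v =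
  Cone-⊆ (DGen⊆Cone-RGen p T Tilde⊆T T⊆Tilde) , Cone-⊆ (RGen⊆Cone-DGen p T Tilde⊆T d≥1)
  where
  Tilde⊆T : ∀ γ → Tilde T γ → γ ∈ T
  Tilde⊆T γ = proj₁ (T̃≡T γ)
  T⊆Tilde : ∀ γ → γ ∈ T → Tilde T γ
  T⊆Tilde γ = proj₂ (T̃≡T γ)
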